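{- Let $\mathcal{O}$ be an $m$-dimensional pseudo unique sink orientation with $m\ge 3$, with vertex set $[V,W]$, such that $V$ is a global sink of $\mathcal{O}$. Then $\mathcal{O}$ contains a directed cycle all of whose vertices are of the form $V\cup\{i\}$ or $V\cup\{i,j\}$ with $i,j\in W\setminus V$.
   Context: Notation: for $U\subseteq W$, $[U,W]=\{X: U\subseteq X\subseteq W\}$; $\oplus$ is symmetric difference. A cube orientation with vertex set $[V,W]$ is a directed graph on $[V,W]$ containing exactly one of the directed edges $(X,X\oplus\{i\})$, $(X\oplus\{i\},X)$ for every $X\in[V,W]$ and $i\in W\setminus V$; its dimension is $m=|W\setminus V|$. A face is the subgraph induced by an interval contained in $[V,W]$; it is proper if the interval is not all of $[V,W]$. A sink is a vertex with no outgoing edges. A pseudo unique sink orientation (pseudo USO) is a cube orientation that does not have a unique global sink but in which every proper face has a unique sink. A global sink is a sink of the whole orientation. -}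

module Defs where

open import Data.Nat using (ℕ; _≤_; _∸_)
open import Data.Bool using (Bool; true; false; not)
open import Data.Fin using (Fin; suc; zero; inject₁; fromℕ)
open import Data.Fin.Subset using (Subset; _∈_; _∉_; _⊆_; _∪_; ⁅_⁆; ∣_∣)
open import Data.Vec using (_[_]%=_)
open import Data.Product using (Σ; _×_; ∃; ∃-syntax; _,_)
open import Data.Sum using (_⊎_)
open import Relation.Binary.PropositionalEquality using (_≡_; _≢_)
open import Relation.Nullary using (¬_)
open import Function.Definitions using (Injective)

_⊕_ : ∀ {n} → Subset n → Fin n → Subset n
X ⊕ i = X [ i ]%= not

_∈[_,_] : ∀ {n} → Subset n → Subset n → Subset n → Set
X ∈[ U , W ] = U ⊆ X × X ⊆ W

_∈_∖_ : ∀ {n} → Fin n → Subset n → Subset n → Set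
i ∈ W ∖ U = i ∈ W × i ∉ U

dim : ∀ {n} → Subset n → Subset n → ℕ
dim V W = ∣ W ∣ ∸ ∣ V ∣

-- A cube orientation on [V,W]: out X i = true means the directed edge
-- (X, X ⊕ {i}) is present; otherwise (X ⊕ {i}, X) is present.
record CubeOrientation {n} (V W : Subset n) : Set where
  field
    out        : Subset n → Fin n → Bool
    consistent : ∀ X i → X ∈[ V , W ] → i ∈ W ∖ V →
                 out (X ⊕ i) i ≡ not (out X i)
open CubeOrientation public

Edge : ∀ {n} {V W : Subset n} → CubeOrientation V W → Subset n → Subset n → Set
Edge {V = V} {W} O X Y =
  X ∈[ V , W ] × ∃[ i ] (i ∈ W ∖ V × out O X i ≡ true × Y ≡ X ⊕ i)

IsFace : ∀ {n} → (V W U U' : Subset n) → Set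
IsFace V W U U' = V ⊆ U × U ⊆ U' × U' ⊆ W

IsSinkOf : ∀ {n} {V W : Subset n} → CubeOrientation V W →
           Subset n → Subset n → Subset n → Set
IsSinkOf O U U' X = X ∈[ U , U' ] × (∀ i → i ∈ U' ∖ U → out O X i ≡ false)

HasUniqueSink : ∀ {n} {V W : Subset n} → CubeOrientation V W →
                Subset n → Subset n → Set
HasUniqueSink O U U' =
  ∃[ X ] (IsSinkOf O U U' X × (∀ Y → IsSinkOf O U U' Y → Y ≡ X))

IsGlobalSink : ∀ {n} {V W : Subset n} → CubeOrientation V W → Subset n → Set
IsGlobalSink {V = V} {W} O X = IsSinkOf O V W X

IsPseudoUSO : ∀ {n} {V W : Subset n} → CubeOrientation V W → Set
IsPseudoUSO {V = V} {W} O =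
  ¬ HasUniqueSink O V W ×
  (∀ U U' → IsFace V W U U' → ¬ (U ≡ V × U' ≡ W) → HasUniqueSink O U U')

record DirectedCycle {n} {V W : Subset n} (O : CubeOrientation V W) : Set where
  field
    k        : ℕ
    vertex   : Fin (ℕ.suc k) → Subset n
    distinct : Injective _≡_ _≡_ vertex
    step     : ∀ (t : Fin k) → Edge O (vertex (inject₁ t)) (vertex (suc t))
    close    : Edge O (vertex (fromℕ k)) (vertex zero)
open DirectedCycle public

LowLevel : ∀ {n} → Subset n → Subset n → Subset n → Set
LowLevel V W X =
  (∃[ i ] (i ∈ W ∖ V × X ≡ V ∪ ⁅ i ⁆)) ⊎
  (∃[ i ] ∃[ j ] (i ∈ W ∖ V × j ∈ W ∖ V × i ≢ j × X ≡ V ∪ (⁅ i ⁆ ∪ ⁅ j ⁆)))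

-- V is a sink of the whole cube but, the orientation being pseudo, not its unique sink.
-- Hence V ∪ {i} is not the sink of the proper facet [V ∪ {i}, W]: a second global sink
-- would lie in that facet or in the opposite one [V, W ∖ {i}], and uniqueness there would
-- force it to be V ∪ {i} (which leaves V ∪ {i} along i) or V.  So V ∪ {i} has an outgoing
-- edge towards some V ∪ {i, j}.  In the 2-face [V, V ∪ {i, j}], proper because m ≥ 3, V is
-- the unique sink, so V ∪ {i, j} must leave along i, to V ∪ {j}.  Repeating from j gives
-- an infinite directed walk through such vertices; it revisits a vertex, and the stretch
-- between the first revisit and the earlier visit is a directed cycle.

module Submission where

open import Defs
open import Data.Bool using (true; false; not)
open import Data.Bool.Properties using (not-involutive; ¬-not; ∨-identityʳ) renaming (_≟_ to _≟ᵇ_)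
open import Data.Empty using (⊥; ⊥-elim)
open import Data.Fin using (Fin; zero; suc; toℕ; _≟_)
open import Data.Fin.Properties using (¬∀⟶∃¬; pigeonhole; toℕ-injective; toℕ<n; toℕ-inject₁; toℕ-fromℕ)
open import Data.Fin.Subset using (Subset; _⊆_; _∈_; _∉_; _∪_; ⁅_⁆; ∣_∣; inside; outside)
open import Data.Fin.Subset.Properties using (_∈?_; ∪-assoc; ∪-identityʳ; p⊆q⇒∣p∣≤∣q∣)
open import Data.Nat using (ℕ; suc; _+_; _*_; _∸_; _≤_; _<_; s≤s; z≤n)
open import Data.Nat.GeneralisedArithmetic using (iterate)
open import Data.Nat.Induction using (<-rec)
open import Data.Nat.Properties
  using (≤-trans; <-cmp; <⇒≢; <⇒≱; n<1+n; m≤n⇒m∸n≡0; m+n∸n≡m; m≤n⇒∃[o]m+o≡n;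
         +-suc; +-identityʳ; +-monoʳ-<; +-cancelˡ-≡; *-suc; *-monoʳ-<; anyUpTo?)
open import Data.Product using (∃-syntax; Σ-syntax; _×_; _,_; proj₁; proj₂)
open import Data.Sum using (inj₁; inj₂)
open import Data.Vec using (_∷_; here; there)
open import Data.Vec.Properties
  using (updateAt-updates; updateAt-minimal; updateAt-updateAt-local; updateAt-id; updateAt-commutes;
         []=-injective; ≡-dec)
open import Function using (_∘_; id; const; case_of_)
open import Relation.Binary.Definitions using (DecidableEquality; tri<; tri≈; tri>)
open import Relation.Binary.PropositionalEquality
open import Relation.Nullary using (¬_; Dec; yes; no)
open import Relation.Nullary.Decidable using (_×-dec_; _→-dec_; ¬?)
open import Relation.Unary using (Pred; Decidable)

private
  variable
    n : ℕ
    p q : Subset n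
    i j x y : Fin n

⊕-involutive : (p : Subset n) (x : Fin n) → (p ⊕ x) ⊕ x ≡ p
⊕-involutive p x = trans (updateAt-updateAt-local x p (not-involutive _)) (updateAt-id x p)

⊕-comm : x ≢ y → (p : Subset n) → (p ⊕ x) ⊕ y ≡ (p ⊕ y) ⊕ x
⊕-comm x≢y p = updateAt-commutes _ _ (x≢y ∘ sym) p

x∈p⇒x∈p⊕y : x ≢ y → x ∈ p → x ∈ p ⊕ y
x∈p⇒x∈p⊕y x≢y x∈p = updateAt-minimal _ _ _ x≢y x∈p

x∈p⊕y⇒x∈p : x ≢ y → x ∈ p ⊕ y → x ∈ p
x∈p⊕y⇒x∈p x≢y x∈p⊕y = subst (_ ∈_) (⊕-involutive _ _) (x∈p⇒x∈p⊕y x≢y x∈p⊕y)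

x∈p⇒x∉p⊕x : x ∈ p → x ∉ p ⊕ x
x∈p⇒x∉p⊕x x∈p x∈p⊕x with () ← []=-injective (updateAt-updates _ _ x∈p) x∈p⊕x

x∉p⇒x∈p⊕x : x ∉ p → x ∈ p ⊕ x
x∉p⇒x∈p⊕x {x = zero}  {p = inside  ∷ p} x∉p = ⊥-elim (x∉p here)
x∉p⇒x∈p⊕x {x = zero}  {p = outside ∷ p} x∉p = here
x∉p⇒x∈p⊕x {x = suc x} {p = _ ∷ p}       x∉p = there (x∉p⇒x∈p⊕x (x∉p ∘ there))

p⊕x≢p : p ⊕ x ≢ p
p⊕x≢p {p = p} {x = x} p⊕x≡p with x ∈? p
... | yes x∈p = x∈p⇒x∉p⊕x x∈p (subst (x ∈_) (sym p⊕x≡p) x∈p)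
... | no  x∉p = x∉p (subst (x ∈_) p⊕x≡p (x∉p⇒x∈p⊕x x∉p))

p⊆q⇒p⊆q⊕x : x ∉ p → p ⊆ q → p ⊆ q ⊕ x
p⊆q⇒p⊆q⊕x {x = x} x∉p p⊆q {y} y∈p with y ≟ x
... | yes refl = ⊥-elim (x∉p y∈p)
... | no  y≢x  = x∈p⇒x∈p⊕y y≢x (p⊆q y∈p)

p⊆q⇒p⊕x⊆q : x ∈ q → p ⊆ q → p ⊕ x ⊆ q
p⊆q⇒p⊕x⊆q {x = x} x∈q p⊆q {y} y∈p⊕x with y ≟ x
... | yes refl = x∈q
... | no  y≢x  = p⊆q (x∈p⊕y⇒x∈p y≢x y∈p⊕x)

x∉p⇒p⊕x≡p∪⁅x⁆ : x ∉ p → p ⊕ x ≡ p ∪ ⁅ x ⁆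
x∉p⇒p⊕x≡p∪⁅x⁆ {x = zero}  {p = inside  ∷ p} x∉p = ⊥-elim (x∉p here)
x∉p⇒p⊕x≡p∪⁅x⁆ {x = zero}  {p = outside ∷ p} x∉p = cong (inside ∷_) (sym (∪-identityʳ p))
x∉p⇒p⊕x≡p∪⁅x⁆ {x = suc x} {p = b ∷ p}       x∉p =
  cong₂ _∷_ (sym (∨-identityʳ b)) (x∉p⇒p⊕x≡p∪⁅x⁆ (x∉p ∘ there))

x∉p⇒∣p⊕x∣≡1+∣p∣ : x ∉ p → ∣ p ⊕ x ∣ ≡ suc ∣ p ∣
x∉p⇒∣p⊕x∣≡1+∣p∣ {x = zero}  {p = inside  ∷ p} x∉p = ⊥-elim (x∉p here)
x∉p⇒∣p⊕x∣≡1+∣p∣ {x = zero}  {p = outside ∷ p} x∉p = refl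
x∉p⇒∣p⊕x∣≡1+∣p∣ {x = suc x} {p = inside  ∷ p} x∉p = cong suc (x∉p⇒∣p⊕x∣≡1+∣p∣ (x∉p ∘ there))
x∉p⇒∣p⊕x∣≡1+∣p∣ {x = suc x} {p = outside ∷ p} x∉p = x∉p⇒∣p⊕x∣≡1+∣p∣ (x∉p ∘ there)

p⊕x⊕y⊕x≡p⊕y : x ≢ y → (p : Subset n) → ((p ⊕ x) ⊕ y) ⊕ x ≡ p ⊕ y
p⊕x⊕y⊕x≡p⊕y x≢y p = trans (cong (_⊕ _) (⊕-comm x≢y p)) (⊕-involutive (p ⊕ _) _)

p⊕x⊕y≡p∪⁅x⁆∪⁅y⁆ : x ∉ p → y ∉ p → y ≢ x → (p ⊕ x) ⊕ y ≡ p ∪ (⁅ x ⁆ ∪ ⁅ y ⁆)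
p⊕x⊕y≡p∪⁅x⁆∪⁅y⁆ {x = x} {p = p} {y = y} x∉p y∉p y≢x = begin
  (p ⊕ x) ⊕ y         ≡⟨ x∉p⇒p⊕x≡p∪⁅x⁆ (y∉p ∘ x∈p⊕y⇒x∈p y≢x) ⟩
  (p ⊕ x) ∪ ⁅ y ⁆     ≡⟨ cong (_∪ ⁅ y ⁆) (x∉p⇒p⊕x≡p∪⁅x⁆ x∉p) ⟩
  (p ∪ ⁅ x ⁆) ∪ ⁅ y ⁆ ≡⟨ ∪-assoc p ⁅ x ⁆ ⁅ y ⁆ ⟩
  p ∪ (⁅ x ⁆ ∪ ⁅ y ⁆) ∎
  where open ≡-Reasoning

dim-p⊕x⊕y≡2 : x ∉ p → y ∉ p → y ≢ x → dim p ((p ⊕ x) ⊕ y) ≡ 2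
dim-p⊕x⊕y≡2 {p = p} x∉p y∉p y≢x = begin
  ∣ (p ⊕ _) ⊕ _ ∣ ∸ ∣ p ∣ ≡⟨ cong (_∸ ∣ p ∣) (x∉p⇒∣p⊕x∣≡1+∣p∣ (y∉p ∘ x∈p⊕y⇒x∈p y≢x)) ⟩
  suc ∣ p ⊕ _ ∣ ∸ ∣ p ∣   ≡⟨ cong (λ m → suc m ∸ ∣ p ∣) (x∉p⇒∣p⊕x∣≡1+∣p∣ x∉p) ⟩
  2 + ∣ p ∣ ∸ ∣ p ∣       ≡⟨ m+n∸n≡m 2 ∣ p ∣ ⟩
  2                       ∎
  where open ≡-Reasoning

module _ {ℓ} {P : Pred (Fin n) ℓ} (P? : Decidable P) where

  ¬∀∖⟶∃∖¬ : ¬ (∀ x → x ∈ q ∖ p → P x) → ∃[ x ] (x ∈ q ∖ p × ¬ P x)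
  ¬∀∖⟶∃∖¬ {q = q} {p = p} ¬∀ = witness (¬∀⟶∃¬ _ (λ x → x ∈ q ∖ p → P x) (λ x → ∈∖? x →-dec P? x) ¬∀)
    where
    ∈∖? : ∀ x → Dec (x ∈ q ∖ p)
    ∈∖? x = (x ∈? q) ×-dec ¬? (x ∈? p)

    witness : ∃[ x ] ¬ (x ∈ q ∖ p → P x) → ∃[ x ] (x ∈ q ∖ p × ¬ P x)
    witness (x , ¬[x∈q∖p→Px]) with ∈∖? x
    ... | yes x∈q∖p = x , x∈q∖p , ¬[x∈q∖p→Px] ∘ const
    ... | no  x∉q∖p = ⊥-elim (¬[x∈q∖p→Px] (⊥-elim ∘ x∉q∖p))

0<dim⇒∃[x]x∈q∖p : 0 < dim p q → ∃[ x ] (x ∈ q ∖ p)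
0<dim⇒∃[x]x∈q∖p {p = p} {q = q} 0<dim =
  let x , x∈q∖p , _ = ¬∀∖⟶∃∖¬ {P = λ _ → ⊥} (λ _ → no id) q∖p-nonempty in x , x∈q∖p
  where
  q∖p-nonempty : ¬ (∀ x → x ∈ q ∖ p → ⊥)
  q∖p-nonempty none = <⇒≢ 0<dim (sym (m≤n⇒m∸n≡0 (p⊆q⇒∣p∣≤∣q∣ q⊆p)))
    where
    q⊆p : q ⊆ p
    q⊆p {x} x∈q with x ∈? p
    ... | yes x∈p = x∈p
    ... | no  x∉p = ⊥-elim (none x (x∈q , x∉p))

module _ {a} {A : Set a} (f : ℕ → A) where

  Revisits : ℕ → Set a
  Revisits c = ∃[ b ] (b < c × f b ≡ f c)

  InjectiveBelow : ℕ → Set a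
  InjectiveBelow c = ∀ {x y} → x < c → y < c → f x ≡ f y → x ≡ y

  no-revisit⇒injective : ∀ {c} → ¬ (∃[ d ] (d < c × Revisits d)) → InjectiveBelow c
  no-revisit⇒injective none {x} {y} x<c y<c fx≡fy with <-cmp x y
  ... | tri< x<y _ _ = ⊥-elim (none (y , y<c , x , x<y , fx≡fy))
  ... | tri≈ _ x≡y _ = x≡y
  ... | tri> _ _ y<x = ⊥-elim (none (x , x<c , y , y<x , sym fx≡fy))

  first-revisit : DecidableEquality A → ∀ c → Revisits c → ∃[ d ] (Revisits d × InjectiveBelow d)
  first-revisit _≟A_ = <-rec (λ c → Revisits c → ∃[ d ] (Revisits d × InjectiveBelow d))
    λ c earlier revisits-c → case anyUpTo? revisits? c of λ where
      (yes (d , d<c , revisits-d)) → earlier d<c revisits-d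
      (no none)                    → c , revisits-c , no-revisit⇒injective none
    where
    revisits? : Decidable Revisits
    revisits? d = anyUpTo? (λ b → f b ≟A f d) d

module _ {V W : Subset n} (O : CubeOrientation V W) (f : ℕ → Subset n) where

  revisit⇒cycle : (∀ t → Edge O (f t) (f (suc t))) → ∀ {b} → Revisits f b →
                  Σ[ C ∈ DirectedCycle O ] (∀ t → ∃[ s ] vertex C t ≡ f s)
  revisit⇒cycle edge {b} revisits-b with first-revisit f (≡-dec _≟ᵇ_) b revisits-b
  ... | c , (a , a<c , fa≡fc) , injective = cycle , λ t → a + toℕ t , refl
    where
    m : ℕ
    m = proj₁ (m≤n⇒∃[o]m+o≡n a<c)

    a+m+1≡c : suc (a + m) ≡ c
    a+m+1≡c = proj₂ (m≤n⇒∃[o]m+o≡n a<c)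

    below : ∀ (t : Fin (suc m)) → a + toℕ t < c
    below t = subst (a + toℕ t <_) (trans (+-suc a m) a+m+1≡c) (+-monoʳ-< a (toℕ<n t))

    cycle : DirectedCycle O
    cycle = record
      { k        = m
      ; vertex   = λ t → f (a + toℕ t)
      ; distinct = λ e → toℕ-injective (+-cancelˡ-≡ a _ _ (injective (below _) (below _) e))
      ; step     = λ t → subst₂ (Edge O) (cong (λ s → f (a + s)) (sym (toℕ-inject₁ t)))
                                         (cong f (sym (+-suc a (toℕ t))))
                                         (edge (a + toℕ t))
      ; close    = subst₂ (Edge O) (cong (λ s → f (a + s)) (sym (toℕ-fromℕ m)))
                                   (trans (cong f a+m+1≡c) (trans (sym fa≡fc) (cong f (sym (+-identityʳ a)))))
                                   (edge (a + m))
      }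

module _ {V W : Subset n} (O : CubeOrientation V W) where

  ProperFacesHaveUniqueSinks : Set
  ProperFacesHaveUniqueSinks =
    ∀ U U′ → IsFace V W U U′ → ¬ (U ≡ V × U′ ≡ W) → HasUniqueSink O U U′

  sinks-coincide : ∀ {U U′ X Y} → HasUniqueSink O U U′ →
                   IsSinkOf O U U′ X → IsSinkOf O U U′ Y → X ≡ Y
  sinks-coincide (_ , _ , unique) X-sink Y-sink = trans (unique _ X-sink) (sym (unique _ Y-sink))

  sink-of-subface : ∀ {U U′ U₁ U₁′ X} → U ⊆ U₁ → U₁′ ⊆ U′ → X ∈[ U₁ , U₁′ ] →
                    IsSinkOf O U U′ X → IsSinkOf O U₁ U₁′ X
  sink-of-subface U⊆U₁ U₁′⊆U′ X∈face (_ , no-out) =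
    X∈face , λ j (j∈U₁′ , j∉U₁) → no-out j (U₁′⊆U′ j∈U₁′ , j∉U₁ ∘ U⊆U₁)

  out-false⇒out-⊕-true : ∀ {X} → X ∈[ V , W ] → i ∈ W ∖ V →
                         out O X i ≡ false → out O (X ⊕ i) i ≡ true
  out-false⇒out-⊕-true X∈cube i∈W∖V X↛ = trans (consistent O _ _ X∈cube i∈W∖V) (cong not X↛)

module _ {V W : Subset n} (O : CubeOrientation V W) (V⊆W : V ⊆ W) (V-sink : IsGlobalSink O V) where

  V⊕i∈cube : i ∈ W ∖ V → (V ⊕ i) ∈[ V , W ]
  V⊕i∈cube (i∈W , i∉V) = p⊆q⇒p⊆q⊕x i∉V id , p⊆q⇒p⊕x⊆q i∈W V⊆W

  V⊕i⊕j∈cube : i ∈ W ∖ V → j ∈ W ∖ V → ((V ⊕ i) ⊕ j) ∈[ V , W ]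
  V⊕i⊕j∈cube i∈W∖V (j∈W , j∉V) with V⊕i∈cube i∈W∖V
  ... | V⊆V⊕i , V⊕i⊆W = p⊆q⇒p⊆q⊕x j∉V V⊆V⊕i , p⊆q⇒p⊕x⊆q j∈W V⊕i⊆W

  upper-facet-sink⇒unique-sink : ProperFacesHaveUniqueSinks O → i ∈ W ∖ V →
                                 IsSinkOf O (V ⊕ i) W (V ⊕ i) → HasUniqueSink O V W
  upper-facet-sink⇒unique-sink {i = i} faces i∈W∖V@(i∈W , i∉V) V⊕i-sink = V , V-sink , unique
    where
    unique : ∀ Y → IsSinkOf O V W Y → Y ≡ V
    unique Y Y-sink@((V⊆Y , Y⊆W) , Y↛) with i ∈? Y
    ... | yes i∈Y = ⊥-elim (Y≢V⊕i (sinks-coincide O upper Y-sink′ V⊕i-sink))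
      where
      upper : HasUniqueSink O (V ⊕ i) W
      upper = faces _ _ (proj₁ (V⊕i∈cube i∈W∖V) , proj₂ (V⊕i∈cube i∈W∖V) , id) (p⊕x≢p ∘ proj₁)
      Y-sink′ : IsSinkOf O (V ⊕ i) W Y
      Y-sink′ = sink-of-subface O (proj₁ (V⊕i∈cube i∈W∖V)) id (p⊆q⇒p⊕x⊆q i∈Y V⊆Y , Y⊆W) Y-sink
      Y≢V⊕i : Y ≢ V ⊕ i
      Y≢V⊕i refl with () ← trans (sym (Y↛ i i∈W∖V))
                                 (out-false⇒out-⊕-true O (id , V⊆W) i∈W∖V (proj₂ V-sink i i∈W∖V))
    ... | no  i∉Y = sinks-coincide O lower Y-sink′ V-sink′
      where
      W⊕i⊆W : W ⊕ i ⊆ W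
      W⊕i⊆W = p⊆q⇒p⊕x⊆q i∈W id
      lower : HasUniqueSink O V (W ⊕ i)
      lower = faces _ _ (id , p⊆q⇒p⊆q⊕x i∉V V⊆W , W⊕i⊆W) (p⊕x≢p ∘ proj₂)
      Y-sink′ : IsSinkOf O V (W ⊕ i) Y
      Y-sink′ = sink-of-subface O id W⊕i⊆W (V⊆Y , p⊆q⇒p⊆q⊕x i∉Y Y⊆W) Y-sink
      V-sink′ : IsSinkOf O V (W ⊕ i) V
      V-sink′ = sink-of-subface O id W⊕i⊆W (id , p⊆q⇒p⊆q⊕x i∉V V⊆W) V-sink

  exit-direction : IsPseudoUSO O → i ∈ W ∖ V →
                   ∃[ j ] (j ∈ W ∖ V × j ≢ i × out O (V ⊕ i) j ≡ true)
  exit-direction {i = i} (not-unique , faces) i∈W∖V@(_ , i∉V)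
    with ¬∀∖⟶∃∖¬ (λ j → out O (V ⊕ i) j ≟ᵇ false) V⊕i-not-sink
    where
    V⊕i-not-sink : ¬ (∀ j → j ∈ W ∖ (V ⊕ i) → out O (V ⊕ i) j ≡ false)
    V⊕i-not-sink no-out =
      not-unique (upper-facet-sink⇒unique-sink faces i∈W∖V ((id , proj₂ (V⊕i∈cube i∈W∖V)) , no-out))
  ... | j , (j∈W , j∉V⊕i) , V⊕i→j = j , (j∈W , j∉V⊕i ∘ x∈p⇒x∈p⊕y j≢i) , j≢i , ¬-not V⊕i→j
    where
    j≢i : j ≢ i
    j≢i refl = j∉V⊕i (x∉p⇒x∈p⊕x i∉V)

  turn-in-2-face : ProperFacesHaveUniqueSinks O → 3 ≤ dim V W → i ∈ W ∖ V → j ∈ W ∖ V → j ≢ i →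
                   out O (V ⊕ i) j ≡ true → out O ((V ⊕ i) ⊕ j) i ≡ true
  turn-in-2-face {i = i} {j = j} faces 3≤dim i∈W∖V@(_ , i∉V) j∈W∖V@(_ , j∉V) j≢i V⊕i→j
    with out O ((V ⊕ i) ⊕ j) i in X↛i
  ... | true  = refl
  ... | false = ⊥-elim (i∉V (subst (i ∈_) (sinks-coincide O face X-sink V-sink′) i∈X))
    where
    X : Subset n
    X = (V ⊕ i) ⊕ j
    X∈cube : X ∈[ V , W ]
    X∈cube = V⊕i⊕j∈cube i∈W∖V j∈W∖V
    X≢W : X ≢ W
    X≢W X≡W = <⇒≱ (n<1+n 2) (subst (3 ≤_) dim≡2 3≤dim)
      where
      dim≡2 : dim V W ≡ 2
      dim≡2 = trans (cong (dim V) (sym X≡W)) (dim-p⊕x⊕y≡2 i∉V j∉V j≢i)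
    face : HasUniqueSink O V X
    face = faces V X (id , X∈cube) (X≢W ∘ proj₂)
    X-sink : IsSinkOf O V X X
    X-sink = (proj₁ X∈cube , id) , X↛
      where
      X↛ : ∀ k → k ∈ X ∖ V → out O X k ≡ false
      X↛ k (k∈X , k∉V) with k ≟ i | k ≟ j
      ... | yes refl | _        = X↛i
      ... | no _     | yes refl = trans (consistent O _ _ (V⊕i∈cube i∈W∖V) j∈W∖V) (cong not V⊕i→j)
      ... | no k≢i   | no k≢j   = ⊥-elim (k∉V (x∈p⊕y⇒x∈p k≢i (x∈p⊕y⇒x∈p k≢j k∈X)))
    V-sink′ : IsSinkOf O V X V
    V-sink′ = sink-of-subface O id (proj₂ X∈cube) (id , proj₁ X∈cube) V-sink
    i∈X : i ∈ X
    i∈X = x∈p⇒x∈p⊕y (j≢i ∘ sym) (x∉p⇒x∈p⊕x i∉V)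

module Walk {V W : Subset n} (O : CubeOrientation V W) (V⊆W : V ⊆ W) (3≤dim : 3 ≤ dim V W)
            (pseudo : IsPseudoUSO O) (V-sink : IsGlobalSink O V) where

  Direction : Set
  Direction = ∃[ i ] (i ∈ W ∖ V)

  exit : ((i , _) : Direction) → ∃[ j ] (j ∈ W ∖ V × j ≢ i × out O (V ⊕ i) j ≡ true)
  exit (_ , i∈W∖V) = exit-direction O V⊆W V-sink pseudo i∈W∖V

  next : Direction → Direction
  next d = proj₁ (exit d) , proj₁ (proj₂ (exit d))

  walk : Direction → ℕ → Subset n
  walk (i , _)   0             = V ⊕ i
  walk d@(i , _) 1             = (V ⊕ i) ⊕ proj₁ (next d)
  walk d         (suc (suc t)) = walk (next d) t

  walk-step : ∀ d t → Edge O (walk d t) (walk d (suc t))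
  walk-step d@(i , i∈W∖V) 0 =
    let j , j∈W∖V , _ , V⊕i→j = exit d in
    V⊕i∈cube O V⊆W V-sink i∈W∖V , j , j∈W∖V , V⊕i→j , refl
  walk-step d@(i , i∈W∖V) 1 =
    let j , j∈W∖V , j≢i , V⊕i→j = exit d in
    V⊕i⊕j∈cube O V⊆W V-sink i∈W∖V j∈W∖V , i , i∈W∖V ,
    turn-in-2-face O V⊆W V-sink (proj₂ pseudo) 3≤dim i∈W∖V j∈W∖V j≢i V⊕i→j ,
    sym (p⊕x⊕y⊕x≡p⊕y (j≢i ∘ sym) V)
  walk-step d (suc (suc t)) = walk-step (next d) t

  walk-low : ∀ d t → LowLevel V W (walk d t)
  walk-low (i , i∈W∖V@(_ , i∉V)) 0 = inj₁ (i , i∈W∖V , x∉p⇒p⊕x≡p∪⁅x⁆ i∉V)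
  walk-low d@(i , i∈W∖V@(_ , i∉V)) 1 =
    let j , j∈W∖V@(_ , j∉V) , j≢i , _ = exit d in
    inj₂ (i , j , i∈W∖V , j∈W∖V , j≢i ∘ sym , p⊕x⊕y≡p∪⁅x⁆∪⁅y⁆ i∉V j∉V j≢i)
  walk-low d (suc (suc t)) = walk-low (next d) t

  walk-even : ∀ d t → walk d (2 * t) ≡ V ⊕ proj₁ (iterate next d t)
  walk-even d 0       = refl
  walk-even d (suc t) = trans (cong (walk d) (*-suc 2 t)) (walk-even (next d) t)

  walk-revisits : ∀ d → ∃[ c ] Revisits (walk d) c
  walk-revisits d
    with t₁ , t₂ , t₁<t₂ , same ← pigeonhole (n<1+n n) (λ t → proj₁ (iterate next d (toℕ t))) =
    2 * toℕ t₂ , 2 * toℕ t₁ , *-monoʳ-< 2 t₁<t₂ ,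
    trans (walk-even d (toℕ t₁)) (trans (cong (V ⊕_) same) (sym (walk-even d (toℕ t₂))))

lemma1 : ∀ {n} (V W : Subset n) → V ⊆ W → 3 ≤ dim V W →
         (O : CubeOrientation V W) → IsPseudoUSO O → IsGlobalSink O V →
         Σ[ C ∈ DirectedCycle O ] (∀ t → LowLevel V W (vertex C t))
lemma1 V W V⊆W 3≤dim O pseudo V-sink =
  let C , on-walk = revisit⇒cycle O (walk d₀) (walk-step d₀) (proj₂ (walk-revisits d₀))
  in  C , on-walk⇒low {C} on-walk
  where
  open Walk O V⊆W 3≤dim pseudo V-sink

  d₀ : Direction
  d₀ = 0<dim⇒∃[x]x∈q∖p (≤-trans (s≤s z≤n) 3≤dim)

  on-walk⇒low : ∀ {C : DirectedCycle O} → (∀ t → ∃[ s ] vertex C t ≡ walk d₀ s) →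
                ∀ t → LowLevel V W (vertex C t)
  on-walk⇒low on-walk t =
    let s , Cₜ≡walkₛ = on-walk t in subst (LowLevel V W) (sym Cₜ≡walkₛ) (walk-low d₀ s)
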